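{- Let $M$ and $N$ be matroids on disjoint finite sets $S$ and $T$, and let $A,A'\subseteq S$ and $B,B'\subseteq T$. If $\mathrm{cl}_M(A)=\mathrm{cl}_M(A')$ and $\mathrm{cl}_{N^*}(B)=\mathrm{cl}_{N^*}(B')$, then $(M,N;A,B)=(M,N;A',B')$. Conversely, if $(M,N;A,B)\neq M\oplus N$ and $(M,N;A,B)=(M,N;A',B')$, then $\mathrm{cl}_M(A)=\mathrm{cl}_M(A')$ and $\mathrm{cl}_{N^*}(B)=\mathrm{cl}_{N^*}(B')$.
   Context: The principal sum $(M,N;A,B)$ is the matroid union $M^+(A,B)\vee N_0$, where: $N_0=N\oplus U_{0,S}$ ($N$ with the elements of $S$ added as loops); $M^+(A,B)$ is the matroid on $S\cup T$ obtained from $M$ by adding each element of $B$ freely (by successive principal extensions) to the flat $\mathrm{cl}_M(A)$ and each element of $T-B$ as a loop, equivalently the matroid with rank function $r(X\cup Y)=\min\{r_M(X\cup A),\,r_M(X)+|Y\cap B|\}$ for $X\subseteq S$, $Y\subseteq T$; and the matroid union $G\vee H$ of matroids on a common set has as independent sets the unions of an independent set of $G$ and an independent set of $H$. $\mathrm{cl}_{N^*}$ is closure in the dual matroid $N^*$. -}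

module Defs where

open import Data.Nat using (ℕ; _+_; _∸_; _≤_; _⊓_; _≟_)
open import Data.Fin using (Fin)
open import Data.Fin.Subset using (Subset; _∪_; _∩_; _⊆_; ∣_∣; ⁅_⁆; ∁; ⊤)
open import Data.Vec using (tabulate; take; drop)
open import Data.Product using (_×_; ∃₂)
open import Relation.Nullary.Decidable using (⌊_⌋)
open import Relation.Binary.PropositionalEquality using (_≡_)

RankFn : ℕ → Set
RankFn n = Subset n → ℕ

record IsMatroidRank {n : ℕ} (r : RankFn n) : Set where
  field
    r-bound  : ∀ X → r X ≤ ∣ X ∣
    r-mono   : ∀ X Y → X ⊆ Y → r X ≤ r Y
    r-submod : ∀ X Y → r (X ∪ Y) + r (X ∩ Y) ≤ r X + r Y

record Matroid (n : ℕ) : Set where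
  field
    rank      : RankFn n
    isMatroid : IsMatroidRank rank

open Matroid public

Independent : ∀ {n} → RankFn n → Subset n → Set
Independent r I = r I ≡ ∣ I ∣

closure : ∀ {n} → RankFn n → Subset n → Subset n
closure r A = tabulate (λ x → ⌊ r (A ∪ ⁅ x ⁆) ≟ r A ⌋)

dualRank : ∀ {n} → RankFn n → RankFn n
dualRank r X = ∣ X ∣ + r (∁ X) ∸ r ⊤

-- Ground set S ∪ T with S = Fin s, T = Fin t (disjoint), realised as Fin (s + t):
-- a subset Z splits as  X = take s Z ⊆ S  and  Y = drop s Z ⊆ T.

plusRank : ∀ {s t} → Matroid s → Subset s → Subset t → RankFn (s + t)
plusRank {s} M A B Z = rank M (take s Z ∪ A) ⊓ (rank M (take s Z) + ∣ drop s Z ∩ B ∣)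

-- N_0 = N ⊕ U_{0,S}.
n0Rank : ∀ {s t} → Matroid t → RankFn (s + t)
n0Rank {s} N Z = rank N (drop s Z)

directSumRank : ∀ {s t} → Matroid s → Matroid t → RankFn (s + t)
directSumRank {s} M N Z = rank M (take s Z) + rank N (drop s Z)

UnionIndep : ∀ {n} → RankFn n → RankFn n → Subset n → Set
UnionIndep g h I = ∃₂ λ I₁ I₂ → (I ≡ I₁ ∪ I₂) × Independent g I₁ × Independent h I₂

PrincipalSumIndep : ∀ {s t} → Matroid s → Matroid t → Subset s → Subset t → Subset (s + t) → Set
PrincipalSumIndep M N A B = UnionIndep (plusRank M A B) (n0Rank N)

-- Two matroids on the same ground set are equal iff they have the same independent sets.
SameMatroid : ∀ {n} → (Subset n → Set) → (Subset n → Set) → Set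
SameMatroid P Q = ∀ I → (P I → Q I) × (Q I → P I)

module Submission where

-- Everything rests on one description of the independent sets: X ∪ Y (X ⊆ S, Y ⊆ T) is
-- independent in (M,N;A,B) iff X is M-independent, Y ─ B is N-independent and
-- |X| + |Y| ≤ r_M(X ∪ A) + r_N(Y); such a split (X,Y) is called feasible.  Comparing two
-- principal sums thus amounts to comparing their feasible splits.
--  * Forward: r_M(X ∪ A) only depends on cl_M(A), and independence of Y ─ B only on
--    cl_{N*}(B), because the elements of cl_{N*}(B) outside B are coloops of N|(T ─ B).
--  * Converse: a principal sum other than M ⊕ N has a feasible split with Y dependent.
--    It yields r_M(A) ≥ 1 and a set Y₁ of nullity one with Y₁ ─ B independent.  Testing the
--    split (basis of A′, Y₁) gives cl_M(A) ⊆ cl_M(A′); testing (∅, J ∪ ⁅ e ⁆) for a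
--    nullity-one set through e ∈ cl_{N*}(B) ─ cl_{N*}(B′) gives cl_{N*}(B) ⊆ cl_{N*}(B′).

open import Defs
open import Data.Nat using (ℕ; zero; suc; _+_; _∸_; _≤_; _<_; z≤n; s≤s; s≤s⁻¹; _⊓_)
open import Data.Nat.Properties
open import Data.Bool.Properties using (T-≡)
open import Data.Fin using (Fin; zero; suc)
open import Data.Fin.Subset
open import Data.Fin.Subset.Properties
open import Data.Vec using (_∷_; []; _++_; take; drop; here; there)
open import Data.Vec.Properties using (take++drop≡id; take-zipWith; drop-zipWith; zipWith-++; lookup∘tabulate; []=⇒lookup; lookup⇒[]=)
open import Data.Product using (_×_; _,_; proj₁; proj₂; ∃; ∃₂)
open import Data.Sum using (_⊎_; inj₁; inj₂; [_,_])
open import Data.Empty using (⊥-elim)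
open import Function using (_∘_; _⇔_; mk⇔; Equivalence)
open import Relation.Nullary using (¬_; yes; no; Dec; contradiction)
open import Relation.Nullary.Decidable using (toWitness; fromWitness; _×-dec_; ¬?)
open import Relation.Binary.PropositionalEquality
  using (_≡_; _≢_; refl; sym; trans; cong; cong₂; subst; subst₂; module ≡-Reasoning)

private variable
  n : ℕ
  x y : Fin n
  p q : Subset n

∈─⁻ : x ∈ p ─ q → x ∈ p × x ∉ q
∈─⁻ {x = zero}  {inside ∷ p}  {outside ∷ q} here      = here , λ ()
∈─⁻ {x = suc x} {_ ∷ p}       {_ ∷ q}       (there m) =
  let x∈p , x∉q = ∈─⁻ {p = p} {q = q} m in there x∈p , x∉q ∘ drop-there

─-empty⇒⊆ : Empty (p ─ q) → p ⊆ q
─-empty⇒⊆ {q = q} p─q-empty {x} x∈p with x ∈? q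
... | yes x∈q = x∈q
... | no  x∉q = ⊥-elim (p─q-empty (x , x∈p∧x∉q⇒x∈p─q x∈p x∉q))

∈∪⁅⁆⁻ : ∀ {x e : Fin n} {p} → x ∈ p ∪ ⁅ e ⁆ → x ∈ p ⊎ x ≡ e
∈∪⁅⁆⁻ {e = e} {p} m = Data.Sum.map₂ (x∈⁅y⁆⇒x≡y e) (x∈p∪q⁻ p ⁅ e ⁆ m)

∪⊆ : ∀ {p q r : Subset n} → p ⊆ r → q ⊆ r → p ∪ q ⊆ r
∪⊆ {p = p} {q} p⊆r q⊆r m = [ p⊆r , q⊆r ] (x∈p∪q⁻ p q m)

∪⁅⁆⊆ : p ⊆ q → y ∈ q → p ∪ ⁅ y ⁆ ⊆ q
∪⁅⁆⊆ p⊆q y∈q = ∪⊆ p⊆q (λ x∈⁅y⁆ → subst (_∈ _) (sym (x∈⁅y⁆⇒x≡y _ x∈⁅y⁆)) y∈q)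

e∈∪⁅e⁆ : ∀ {e : Fin n} {p} → e ∈ p ∪ ⁅ e ⁆
e∈∪⁅e⁆ {e = e} {p} = q⊆p∪q p ⁅ e ⁆ (x∈⁅x⁆ e)

∈∁∪⁅⁆ : ∀ {B : Subset n} {x e} → x ∉ B → x ≢ e → x ∈ ∁ (B ∪ ⁅ e ⁆)
∈∁∪⁅⁆ {B = B} x∉B x≢e = x∉p⇒x∈∁p (λ m → [ x∉B , x≢e ] (∈∪⁅⁆⁻ {p = B} m))

∁⊆∁∪⁅⁆∪⁅⁆ : ∀ {B : Subset n} {e} → ∁ B ⊆ ∁ (B ∪ ⁅ e ⁆) ∪ ⁅ e ⁆
∁⊆∁∪⁅⁆∪⁅⁆ {e = e} {x} x∈∁B with x Data.Fin.≟ e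
... | yes refl = e∈∪⁅e⁆
... | no  x≢e  = p⊆p∪q _ (∈∁∪⁅⁆ (x∈∁p⇒x∉p x∈∁B) x≢e)

∣p∪⁅x⁆∣ : x ∉ p → ∣ p ∪ ⁅ x ⁆ ∣ ≡ suc ∣ p ∣
∣p∪⁅x⁆∣ {x = zero}  {inside ∷ p}  x∉p = ⊥-elim (x∉p here)
∣p∪⁅x⁆∣ {x = zero}  {outside ∷ p} x∉p = cong (suc ∘ ∣_∣) (∪-identityʳ p)
∣p∪⁅x⁆∣ {x = suc x} {inside ∷ p}  x∉p = cong suc (∣p∪⁅x⁆∣ (x∉p ∘ there))
∣p∪⁅x⁆∣ {x = suc x} {outside ∷ p} x∉p = ∣p∪⁅x⁆∣ (x∉p ∘ there)

∣p∣≡∣p∩q∣+∣p─q∣ : ∀ (p q : Subset n) → ∣ p ∣ ≡ ∣ p ∩ q ∣ + ∣ p ─ q ∣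
∣p∣≡∣p∩q∣+∣p─q∣ []            []            = refl
∣p∣≡∣p∩q∣+∣p─q∣ (inside ∷ p)  (inside ∷ q)  = cong suc (∣p∣≡∣p∩q∣+∣p─q∣ p q)
∣p∣≡∣p∩q∣+∣p─q∣ (inside ∷ p)  (outside ∷ q) =
  trans (cong suc (∣p∣≡∣p∩q∣+∣p─q∣ p q)) (sym (+-suc _ _))
∣p∣≡∣p∩q∣+∣p─q∣ (outside ∷ p) (inside ∷ q)  = ∣p∣≡∣p∩q∣+∣p─q∣ p q
∣p∣≡∣p∩q∣+∣p─q∣ (outside ∷ p) (outside ∷ q) = ∣p∣≡∣p∩q∣+∣p─q∣ p q

p─r⊆p─q : ∀ {p q r : Subset n} → q ⊆ r → p ─ r ⊆ p ─ q
p─r⊆p─q q⊆r m = let x∈p , x∉r = ∈─⁻ m in x∈p∧x∉q⇒x∈p─q x∈p (x∉r ∘ q⊆r)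

[p─q]∪q≡p : ∀ {p q : Subset n} → q ⊆ p → (p ─ q) ∪ q ≡ p
[p─q]∪q≡p {p = p} {q} q⊆p = ⊆-antisym (λ m → [ proj₁ ∘ ∈─⁻ , q⊆p ] (x∈p∪q⁻ (p ─ q) q m)) p⊆
  where
  p⊆ : p ⊆ (p ─ q) ∪ q
  p⊆ {x} x∈p with x ∈? q
  ... | yes x∈q = q⊆p∪q (p ─ q) q x∈q
  ... | no  x∉q = p⊆p∪q q (x∈p∧x∉q⇒x∈p─q x∈p x∉q)

∣p∪q∣≤∣p∣+∣q∣ : ∀ (p q : Subset n) → ∣ p ∪ q ∣ ≤ ∣ p ∣ + ∣ q ∣
∣p∪q∣≤∣p∣+∣q∣ []            []            = z≤n
∣p∪q∣≤∣p∣+∣q∣ (inside ∷ p)  (inside ∷ q)  = s≤s (≤-trans (∣p∪q∣≤∣p∣+∣q∣ p q) (+-monoʳ-≤ ∣ p ∣ (n≤1+n _)))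
∣p∪q∣≤∣p∣+∣q∣ (inside ∷ p)  (outside ∷ q) = s≤s (∣p∪q∣≤∣p∣+∣q∣ p q)
∣p∪q∣≤∣p∣+∣q∣ (outside ∷ p) (inside ∷ q)  = ≤-trans (s≤s (∣p∪q∣≤∣p∣+∣q∣ p q)) (≤-reflexive (sym (+-suc _ _)))
∣p∪q∣≤∣p∣+∣q∣ (outside ∷ p) (outside ∷ q) = ∣p∪q∣≤∣p∣+∣q∣ p q

∣p∣≡∣p─q∣+∣q∣ : ∀ {p q : Subset n} → q ⊆ p → ∣ p ∣ ≡ ∣ p ─ q ∣ + ∣ q ∣
∣p∣≡∣p─q∣+∣q∣ {p = p} {q} q⊆p = begin
  ∣ p ∣                   ≡⟨ ∣p∣≡∣p∩q∣+∣p─q∣ p q ⟩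
  ∣ p ∩ q ∣ + ∣ p ─ q ∣   ≡⟨ cong (λ r → ∣ r ∣ + ∣ p ─ q ∣) (⊆-antisym (p∩q⊆q p q) (λ m → x∈p∩q⁺ (q⊆p m , m))) ⟩
  ∣ q ∣ + ∣ p ─ q ∣       ≡⟨ +-comm ∣ q ∣ _ ⟩
  ∣ p ─ q ∣ + ∣ q ∣       ∎
  where open ≡-Reasoning

∣p∣≡0⇒Empty : ∣ p ∣ ≡ 0 → Empty p
∣p∣≡0⇒Empty {p = inside ∷ p}  ()
∣p∣≡0⇒Empty {p = outside ∷ p} eq (zero , ())
∣p∣≡0⇒Empty {p = outside ∷ p} eq (suc x , there m) = ∣p∣≡0⇒Empty eq (x , m)

take-++ : ∀ {s t} (X : Subset s) (Y : Subset t) → take s (X ++ Y) ≡ X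
take-++ []      Y = refl
take-++ (b ∷ X) Y = cong (b ∷_) (take-++ X Y)

drop-++ : ∀ {s t} (X : Subset s) (Y : Subset t) → drop s (X ++ Y) ≡ Y
drop-++ []      Y = refl
drop-++ (b ∷ X) Y = drop-++ X Y

∣X++Y∣ : ∀ {s t} (X : Subset s) (Y : Subset t) → ∣ X ++ Y ∣ ≡ ∣ X ∣ + ∣ Y ∣
∣X++Y∣ []            Y = refl
∣X++Y∣ (inside ∷ X)  Y = cong suc (∣X++Y∣ X Y)
∣X++Y∣ (outside ∷ X) Y = ∣X++Y∣ X Y

∣take∣+∣drop∣ : ∀ s {t} (Z : Subset (s + t)) → ∣ Z ∣ ≡ ∣ take s Z ∣ + ∣ drop s Z ∣
∣take∣+∣drop∣ s Z = trans (cong ∣_∣ (sym (take++drop≡id s Z))) (∣X++Y∣ (take s Z) (drop s Z))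

tight-sum : ∀ {a b c d} → a ≤ c → b ≤ d → c + d ≤ a + b → a ≡ c × b ≡ d
tight-sum {a} {b} {c} {d} a≤c b≤d c+d≤a+b =
  ≤-antisym a≤c (+-cancelʳ-≤ d _ _ (≤-trans c+d≤a+b (+-monoʳ-≤ a b≤d))) ,
  ≤-antisym b≤d (+-cancelˡ-≤ c _ _ (≤-trans c+d≤a+b (+-monoˡ-≤ b a≤c)))

build-up : ∀ {T K : Subset n} (Inv : Subset n → Set) →
           (∀ {K e} → K ⊆ T → e ∈ T → e ∉ K → Inv K → Inv (K ∪ ⁅ e ⁆)) →
           K ⊆ T → Inv K → Inv T
build-up {n} {T} {K} Inv step K⊆T inv = go (n ∸ ∣ K ∣) (m∸n+n≡m (∣p∣≤n K)) K⊆T inv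
  where
  -- the fuel k bounds the number of elements that can still be added
  go : ∀ k {K} → k + ∣ K ∣ ≡ n → K ⊆ T → Inv K → Inv T
  go k {K} size K⊆T inv with nonempty? (T ─ K)
  ... | no T─K-empty = subst Inv (⊆-antisym K⊆T (─-empty⇒⊆ T─K-empty)) inv
  ... | yes (e , e∈T─K) = grow k size
    where
    e∈T = proj₁ (∈─⁻ e∈T─K)
    e∉K = proj₂ (∈─⁻ e∈T─K)
    grow : ∀ k → k + ∣ K ∣ ≡ n → Inv T
    grow zero    size = contradiction (∣p∣≤n (K ∪ ⁅ e ⁆))
                          (<⇒≱ (subst (_< ∣ K ∪ ⁅ e ⁆ ∣) size (≤-reflexive (sym (∣p∪⁅x⁆∣ e∉K)))))
    grow (suc k) size = go k (trans (cong (k +_) (∣p∪⁅x⁆∣ e∉K)) (trans (+-suc k _) size))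
                          (∪⁅⁆⊆ K⊆T e∈T) (step K⊆T e∈T e∉K inv)

module _ {n} (r : RankFn n) where

  ∈closure⁻ : ∀ {A e} → e ∈ closure r A → r (A ∪ ⁅ e ⁆) ≡ r A
  ∈closure⁻ {e = e} m = toWitness (Equivalence.from T-≡ (trans (sym (lookup∘tabulate _ e)) ([]=⇒lookup m)))

  ∈closure⁺ : ∀ {A e} → r (A ∪ ⁅ e ⁆) ≡ r A → e ∈ closure r A
  ∈closure⁺ {e = e} h = lookup⇒[]= e _ (trans (lookup∘tabulate _ e) (Equivalence.to T-≡ (fromWitness h)))

  ⊆closure : ∀ {A} → A ⊆ closure r A
  ⊆closure e∈A = ∈closure⁺ (cong r (⊆-antisym (∪⁅⁆⊆ ⊆-refl e∈A) (p⊆p∪q _)))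

module RankFacts {n} {r : RankFn n} (isM : IsMatroidRank r) where
  open IsMatroidRank isM

  private variable
    A A′ D I J P Q X : Subset n

  ⊥-independent : Independent r ⊥
  ⊥-independent = trans (n≤0⇒n≡0 (subst (r ⊥ ≤_) (∣⊥∣≡0 n) (r-bound ⊥))) (sym (∣⊥∣≡0 n))

  subadditive : ∀ X Y → r (X ∪ Y) ≤ r X + r Y
  subadditive X Y = ≤-trans (m≤m+n _ _) (r-submod X Y)

  rank-step : ∀ X e → r (X ∪ ⁅ e ⁆) ≤ suc (r X)
  rank-step X e = begin
    r (X ∪ ⁅ e ⁆)   ≤⟨ subadditive X ⁅ e ⁆ ⟩
    r X + r ⁅ e ⁆   ≤⟨ +-monoʳ-≤ (r X) (subst (r ⁅ e ⁆ ≤_) (∣⁅x⁆∣≡1 e) (r-bound ⁅ e ⁆)) ⟩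
    r X + 1         ≡⟨ +-comm (r X) 1 ⟩
    suc (r X)       ∎
    where open ≤-Reasoning

  -- Subsets of independent sets are independent: the elements of I outside J
  -- contribute at most their number to r I = ∣ I ∣.
  independent-⊆ : J ⊆ I → Independent r I → Independent r J
  independent-⊆ {J} {I} J⊆I indI = ≤-antisym (r-bound J) (+-cancelˡ-≤ ∣ I ─ J ∣ _ _ (begin
    ∣ I ─ J ∣ + ∣ J ∣   ≡⟨ sym (∣p∣≡∣p─q∣+∣q∣ J⊆I) ⟩
    ∣ I ∣               ≡⟨ sym indI ⟩
    r I                 ≡⟨ cong r (sym ([p─q]∪q≡p J⊆I)) ⟩
    r ((I ─ J) ∪ J)     ≤⟨ subadditive (I ─ J) J ⟩
    r (I ─ J) + r J     ≤⟨ +-monoˡ-≤ (r J) (r-bound (I ─ J)) ⟩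
    ∣ I ─ J ∣ + r J     ∎))
    where open ≤-Reasoning

  diminishing-returns : ∀ {K W} e → K ⊆ W → r (W ∪ ⁅ e ⁆) + r K ≤ r (K ∪ ⁅ e ⁆) + r W
  diminishing-returns {K} {W} e K⊆W = begin
    r (W ∪ ⁅ e ⁆) + r K                             ≤⟨ +-mono-≤ (r-mono _ _ W∪e⊆) (r-mono _ _ K⊆) ⟩
    r ((K ∪ ⁅ e ⁆) ∪ W) + r ((K ∪ ⁅ e ⁆) ∩ W)       ≤⟨ r-submod (K ∪ ⁅ e ⁆) W ⟩
    r (K ∪ ⁅ e ⁆) + r W                             ∎
    where
    open ≤-Reasoning
    W∪e⊆ : W ∪ ⁅ e ⁆ ⊆ (K ∪ ⁅ e ⁆) ∪ W
    W∪e⊆ = ∪⁅⁆⊆ (q⊆p∪q _ W) (p⊆p∪q W e∈∪⁅e⁆)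
    K⊆ : K ⊆ (K ∪ ⁅ e ⁆) ∩ W
    K⊆ x∈K = x∈p∩q⁺ (p⊆p∪q _ x∈K , K⊆W x∈K)

  spanned-⊆ : ∀ e → P ⊆ Q → r (P ∪ ⁅ e ⁆) ≡ r P → r (Q ∪ ⁅ e ⁆) ≡ r Q
  spanned-⊆ {P} {Q} e P⊆Q spanned = ≤-antisym (+-cancelʳ-≤ (r P) _ _ (begin
    r (Q ∪ ⁅ e ⁆) + r P   ≤⟨ diminishing-returns e P⊆Q ⟩
    r (P ∪ ⁅ e ⁆) + r Q   ≡⟨ cong (_+ r Q) spanned ⟩
    r P + r Q             ≡⟨ +-comm (r P) (r Q) ⟩
    r Q + r P             ∎))
    (r-mono _ _ (p⊆p∪q _))
    where open ≤-Reasoning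

  spanned-absorbed : (∀ {e} → e ∈ D → r (J ∪ ⁅ e ⁆) ≡ r J) → r (J ∪ D) ≡ r J
  spanned-absorbed {D} {J} spanned =
    proj₂ (build-up (λ K → J ⊆ K × r K ≡ r J) step (p⊆p∪q D) (⊆-refl , refl))
    where
    step : ∀ {K e} → K ⊆ J ∪ D → e ∈ J ∪ D → e ∉ K → J ⊆ K × r K ≡ r J →
           J ⊆ K ∪ ⁅ e ⁆ × r (K ∪ ⁅ e ⁆) ≡ r J
    step {K} {e} _ e∈J∪D e∉K (J⊆K , rK≡rJ) with x∈p∪q⁻ J D e∈J∪D
    ... | inj₁ e∈J = contradiction (J⊆K e∈J) e∉K
    ... | inj₂ e∈D = p⊆p∪q _ ∘ J⊆K , trans (spanned-⊆ e J⊆K (spanned e∈D)) rK≡rJ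

  basis-extension : ∀ {J₀ Y} → J₀ ⊆ Y → Independent r J₀ →
                    ∃ λ J → J₀ ⊆ J × J ⊆ Y × Independent r J × r J ≡ r Y
  basis-extension {J₀} {Y} J₀⊆Y indJ₀ =
    build-up BasisOf step J₀⊆Y (J₀ , ⊆-refl , ⊆-refl , indJ₀ , refl)
    where
    BasisOf : Subset n → Set
    BasisOf K = ∃ λ J → J₀ ⊆ J × J ⊆ K × Independent r J × r J ≡ r K
    step : ∀ {K e} → K ⊆ Y → e ∈ Y → e ∉ K → BasisOf K → BasisOf (K ∪ ⁅ e ⁆)
    step {K} {e} _ _ e∉K (J , J₀⊆J , J⊆K , indJ , rJ≡rK) with r (J ∪ ⁅ e ⁆) ≟ suc (r J)
    ... | yes grows = J ∪ ⁅ e ⁆ , p⊆p∪q _ ∘ J₀⊆J , ∪⁅⁆⊆ (p⊆p∪q _ ∘ J⊆K) e∈∪⁅e⁆ ,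
                      trans grows (trans (cong suc indJ) (sym (∣p∪⁅x⁆∣ (e∉K ∘ J⊆K)))) ,
                      ≤-antisym (r-mono _ _ (∪⁅⁆⊆ (p⊆p∪q _ ∘ J⊆K) e∈∪⁅e⁆))
                        (≤-trans (rank-step K e) (≤-reflexive (trans (cong suc (sym rJ≡rK)) (sym grows))))
    ... | no stays = J , J₀⊆J , p⊆p∪q _ ∘ J⊆K , indJ ,
                     trans rJ≡rK (sym (spanned-⊆ e J⊆K spannedJ))
      where
      spannedJ : r (J ∪ ⁅ e ⁆) ≡ r J
      spannedJ = ≤-antisym (s≤s⁻¹ (≤∧≢⇒< (rank-step J e) stays)) (r-mono _ _ (p⊆p∪q _))

  spanned-within : ∀ {J W} e → J ∪ ⁅ e ⁆ ⊆ W → r W ≤ r J → r (J ∪ ⁅ e ⁆) ≡ r J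
  spanned-within e J∪e⊆W rW≤rJ = ≤-antisym (≤-trans (r-mono _ _ J∪e⊆W) rW≤rJ) (r-mono _ _ (p⊆p∪q _))

  nullity-one : ∀ {J e} → e ∉ J → Independent r J → r (J ∪ ⁅ e ⁆) ≡ r J →
                ∣ J ∪ ⁅ e ⁆ ∣ ≡ suc (r (J ∪ ⁅ e ⁆))
  nullity-one e∉J indJ spanned = trans (∣p∪⁅x⁆∣ e∉J) (cong suc (sym (trans spanned indJ)))

  nullity-one-subset : ∀ {K Y} → K ⊆ Y → Independent r K → ¬ Independent r Y →
    ∃₂ λ J y → K ⊆ J × J ∪ ⁅ y ⁆ ⊆ Y × y ∉ J × Independent r J × r (J ∪ ⁅ y ⁆) ≡ r J
  nullity-one-subset {Y = Y} K⊆Y indK depY with basis-extension K⊆Y indK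
  ... | J , K⊆J , J⊆Y , indJ , rJ≡rY with nonempty? (Y ─ J)
  ...   | no  Y─J-empty = contradiction
            (subst (Independent r) (⊆-antisym J⊆Y (─-empty⇒⊆ Y─J-empty)) indJ) depY
  ...   | yes (y , y∈Y─J) = J , y , K⊆J , J∪y⊆Y , proj₂ (∈─⁻ y∈Y─J) , indJ ,
            spanned-within y J∪y⊆Y (≤-reflexive (sym rJ≡rY))
    where
    J∪y⊆Y : J ∪ ⁅ y ⁆ ⊆ Y
    J∪y⊆Y = ∪⁅⁆⊆ J⊆Y (proj₁ (∈─⁻ y∈Y─J))

  rank-∪-closure : A′ ⊆ closure r A → ∀ X → r (X ∪ A′) ≤ r (X ∪ A)
  rank-∪-closure {A′} {A} A′⊆clA X = begin
    r (X ∪ A′)          ≤⟨ r-mono _ _ (∪⊆ (p⊆p∪q A′ ∘ p⊆p∪q A) (q⊆p∪q _ A′)) ⟩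
    r ((X ∪ A) ∪ A′)    ≡⟨ spanned-absorbed (λ e∈A′ → spanned-⊆ _ (q⊆p∪q X A) (∈closure⁻ r (A′⊆clA e∈A′))) ⟩
    r (X ∪ A)           ∎
    where open ≤-Reasoning

  -- If A adds nothing to some X ⊆ A′, then cl(A) ⊆ cl(X) ⊆ cl(A′).
  closure-⊆ : X ⊆ A′ → r (X ∪ A) ≤ r X → closure r A ⊆ closure r A′
  closure-⊆ {X} {A = A} X⊆A′ rX∪A≤rX {e} e∈clA = ∈closure⁺ r (spanned-⊆ e X⊆A′ spannedX)
    where
    spannedX : r (X ∪ ⁅ e ⁆) ≡ r X
    spannedX = spanned-within e (∪⁅⁆⊆ (p⊆p∪q _ ∘ p⊆p∪q A) e∈∪⁅e⁆)
      (≤-trans (≤-reflexive (spanned-⊆ e (q⊆p∪q X A) (∈closure⁻ r e∈clA))) rX∪A≤rX)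

module Coclosure {n} {σ : RankFn n} (isM : IsMatroidRank σ) where
  open IsMatroidRank isM
  open RankFacts isM

  private variable
    B B′ K Y : Subset n
    e : Fin n

  -- e is a coloop of the restriction N|∁B: removing it from ∁ B drops the rank.
  IsColoop : Subset n → Fin n → Set
  IsColoop B e = suc (σ (∁ (B ∪ ⁅ e ⁆))) ≡ σ (∁ B)

  -- σ E ≤ ∣ P ∣ + σ (∁ P), so the subtraction in dualRank never truncates.
  rank-⊤-bound : ∀ P → σ ⊤ ≤ ∣ P ∣ + σ (∁ P)
  rank-⊤-bound P = begin
    σ ⊤               ≡⟨ cong σ (sym (p∪∁p≡⊤ P)) ⟩
    σ (P ∪ ∁ P)       ≤⟨ subadditive P (∁ P) ⟩
    σ P + σ (∁ P)     ≤⟨ +-monoˡ-≤ _ (r-bound P) ⟩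
    ∣ P ∣ + σ (∁ P)   ∎
    where open ≤-Reasoning

  coclosure⇔coloop : e ∉ B → (e ∈ closure (dualRank σ) B ⇔ IsColoop B e)
  coclosure⇔coloop {e} {B} e∉B = mk⇔
    (λ e∈cl → +-cancelˡ-≡ ∣ B ∣ _ _ (trans (sym size-shift)
      (∸-cancelʳ-≡ (rank-⊤-bound _) (rank-⊤-bound B) (∈closure⁻ (dualRank σ) e∈cl))))
    (λ coloop → ∈closure⁺ (dualRank σ) (cong (_∸ σ ⊤) (trans size-shift (cong (∣ B ∣ +_) coloop))))
    where
    size-shift : ∣ B ∪ ⁅ e ⁆ ∣ + σ (∁ (B ∪ ⁅ e ⁆)) ≡ ∣ B ∣ + suc (σ (∁ (B ∪ ⁅ e ⁆)))
    size-shift = trans (cong (_+ σ (∁ (B ∪ ⁅ e ⁆))) (∣p∪⁅x⁆∣ e∉B)) (sym (+-suc ∣ B ∣ _))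

  non-coloop-rank : ¬ IsColoop B e → σ (∁ B) ≤ σ (∁ (B ∪ ⁅ e ⁆))
  non-coloop-rank {e = e} ¬coloop = s≤s⁻¹ (≤∧≢⇒<
    (≤-trans (r-mono _ _ ∁⊆∁∪⁅⁆∪⁅⁆) (rank-step _ e)) (¬coloop ∘ sym))

  coloop-extend : K ⊆ ∁ B → e ∉ K → IsColoop B e → Independent σ K → Independent σ (K ∪ ⁅ e ⁆)
  coloop-extend {K} {B} {e} K⊆∁B e∉K coloop indK =
    ≤-antisym (r-bound _) (subst (_≤ σ (K ∪ ⁅ e ⁆)) size (+-cancelˡ-≤ (σ W) _ _ gain))
    where
    W = ∁ (B ∪ ⁅ e ⁆)
    K⊆W : K ⊆ W
    K⊆W x∈K = ∈∁∪⁅⁆ (x∈∁p⇒x∉p (K⊆∁B x∈K)) (λ { refl → e∉K x∈K })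
    size : suc (σ K) ≡ ∣ K ∪ ⁅ e ⁆ ∣
    size = trans (cong suc indK) (sym (∣p∪⁅x⁆∣ e∉K))
    gain : σ W + suc (σ K) ≤ σ W + σ (K ∪ ⁅ e ⁆)
    gain = begin
      σ W + suc (σ K)         ≡⟨ +-suc (σ W) (σ K) ⟩
      suc (σ W) + σ K         ≡⟨ cong (_+ σ K) coloop ⟩
      σ (∁ B) + σ K           ≤⟨ +-monoˡ-≤ (σ K) (r-mono _ _ ∁⊆∁∪⁅⁆∪⁅⁆) ⟩
      σ (W ∪ ⁅ e ⁆) + σ K     ≤⟨ diminishing-returns e K⊆W ⟩
      σ (K ∪ ⁅ e ⁆) + σ W     ≡⟨ +-comm (σ (K ∪ ⁅ e ⁆)) (σ W) ⟩
      σ W + σ (K ∪ ⁅ e ⁆)     ∎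
      where open ≤-Reasoning

  -- Removing B or its coclosure from Y makes no difference to independence:
  -- the extra elements are coloops of N|∁B.
  independent-─-coclosure : Independent σ (Y ─ closure (dualRank σ) B) → Independent σ (Y ─ B)
  independent-─-coclosure {Y} {B} ind =
    proj₂ (build-up (λ K → Y ─ C ⊆ K × Independent σ K) step (p─r⊆p─q (⊆closure (dualRank σ))) (⊆-refl , ind))
    where
    C = closure (dualRank σ) B
    step : ∀ {K e} → K ⊆ Y ─ B → e ∈ Y ─ B → e ∉ K → Y ─ C ⊆ K × Independent σ K →
           Y ─ C ⊆ K ∪ ⁅ e ⁆ × Independent σ (K ∪ ⁅ e ⁆)
    step {K} {e} K⊆Y─B e∈Y─B e∉K (Y─C⊆K , indK) =
      p⊆p∪q _ ∘ Y─C⊆K , coloop-extend K⊆∁B e∉K (Equivalence.to (coclosure⇔coloop e∉B) e∈C) indK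
      where
      e∉B = proj₂ (∈─⁻ e∈Y─B)
      K⊆∁B : K ⊆ ∁ B
      K⊆∁B = x∉p⇒x∈∁p ∘ proj₂ ∘ ∈─⁻ ∘ K⊆Y─B
      e∈C : e ∈ C
      e∈C with e ∈? C
      ... | yes e∈C = e∈C
      ... | no  e∉C = contradiction (Y─C⊆K (x∈p∧x∉q⇒x∈p─q (proj₁ (∈─⁻ e∈Y─B)) e∉C)) e∉K

  independent-─-invariant : closure (dualRank σ) B ≡ closure (dualRank σ) B′ →
                            Independent σ (Y ─ B) → Independent σ (Y ─ B′)
  independent-─-invariant {B} {Y = Y} same ind = independent-─-coclosure
    (subst (λ C → Independent σ (Y ─ C)) same (independent-⊆ (p─r⊆p─q (⊆closure (dualRank σ))) ind))

  outside-coclosure-circuit : e ∉ closure (dualRank σ) B →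
    ∃ λ J → J ∪ ⁅ e ⁆ ⊆ ∁ B × e ∉ J × Independent σ J × σ (J ∪ ⁅ e ⁆) ≡ σ J
  outside-coclosure-circuit {e} {B} e∉cl with basis-extension (⊆-min (∁ (B ∪ ⁅ e ⁆))) ⊥-independent
  ... | J , _ , J⊆W , indJ , rJ≡rW =
    J , J∪e⊆∁B , e∉J , indJ , spanned-within e J∪e⊆∁B (≤-trans (non-coloop-rank ¬coloop) (≤-reflexive (sym rJ≡rW)))
    where
    e∉B : e ∉ B
    e∉B = e∉cl ∘ ⊆closure (dualRank σ)
    ¬coloop : ¬ IsColoop B e
    ¬coloop = e∉cl ∘ Equivalence.from (coclosure⇔coloop e∉B)
    e∉J : e ∉ J
    e∉J e∈J = x∈∁p⇒x∉p (J⊆W e∈J) e∈∪⁅e⁆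
    J∪e⊆∁B : J ∪ ⁅ e ⁆ ⊆ ∁ B
    J∪e⊆∁B = ∪⁅⁆⊆ (p⊆q⇒∁p⊇∁q (p⊆p∪q _) ∘ J⊆W) (x∉p⇒x∈∁p e∉B)

module PrincipalSum {s t} (M : Matroid s) (N : Matroid t) where
  private
    ρ = rank M
    σ = rank N
    module Mʳ = IsMatroidRank (isMatroid M)
    module Nʳ = IsMatroidRank (isMatroid N)
    module Mᶠ = RankFacts (isMatroid M)
    module Nᶠ = RankFacts (isMatroid N)
    module Nᶜ = Coclosure (isMatroid N)

  -- The independent sets X ∪ Y of (M,N;A,B), split into S-part X and T-part Y:
  -- X is M-independent, Y ─ B is N-independent and the sizes fit under the ranks.
  Feasible : Subset s → Subset t → Subset s → Subset t → Set
  Feasible A B X Y = Independent ρ X × Independent σ (Y ─ B) × ∣ X ∣ + ∣ Y ∣ ≤ ρ (X ∪ A) + σ Y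

  plus-independent⁻ : ∀ {A B} (Z : Subset (s + t)) → Independent (plusRank M A B) Z →
    Independent ρ (take s Z) × drop s Z ⊆ B × ∣ take s Z ∣ + ∣ drop s Z ∣ ≤ ρ (take s Z ∪ A)
  plus-independent⁻ {A} {B} Z indZ = indX , ─-empty⇒⊆ (∣p∣≡0⇒Empty ∣Y─B∣≡0) , fits (m⊓n≤m _ _)
    where
    X = take s Z
    Y = drop s Z
    -- both terms of the minimum bound ∣ Z ∣ = ∣ X ∣ + ∣ Y ∣ from above
    fits : ∀ {k} → ρ (X ∪ A) ⊓ (ρ X + ∣ Y ∩ B ∣) ≤ k → ∣ X ∣ + ∣ Y ∣ ≤ k
    fits bound = subst (_≤ _) (trans indZ (∣take∣+∣drop∣ s Z)) bound
    tight = tight-sum (Mʳ.r-bound X) (∣p∩q∣≤∣p∣ Y B) (fits (m⊓n≤n _ _))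
    indX : Independent ρ X
    indX = proj₁ tight
    ∣Y─B∣≡0 : ∣ Y ─ B ∣ ≡ 0
    ∣Y─B∣≡0 = +-cancelˡ-≡ ∣ Y ∩ B ∣ _ _
      (trans (sym (∣p∣≡∣p∩q∣+∣p─q∣ Y B)) (trans (sym (proj₂ tight)) (sym (+-identityʳ ∣ Y ∩ B ∣))))

  plus-independent⁺ : ∀ {A B} {X : Subset s} {Y : Subset t} →
    Independent ρ X → Y ⊆ B → ∣ X ∣ + ∣ Y ∣ ≤ ρ (X ∪ A) → Independent (plusRank M A B) (X ++ Y)
  plus-independent⁺ {A} {B} {X} {Y} indX Y⊆B fits = begin
    ρ (take s (X ++ Y) ∪ A) ⊓ (ρ (take s (X ++ Y)) + ∣ drop s (X ++ Y) ∩ B ∣)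
      ≡⟨ cong₂ (λ X′ Y′ → ρ (X′ ∪ A) ⊓ (ρ X′ + ∣ Y′ ∩ B ∣)) (take-++ X Y) (drop-++ X Y) ⟩
    ρ (X ∪ A) ⊓ (ρ X + ∣ Y ∩ B ∣)
      ≡⟨ cong₂ (λ k Y′ → ρ (X ∪ A) ⊓ (k + ∣ Y′ ∣)) indX (⊆-antisym (p∩q⊆p Y B) (λ m → x∈p∩q⁺ (m , Y⊆B m))) ⟩
    ρ (X ∪ A) ⊓ (∣ X ∣ + ∣ Y ∣)  ≡⟨ m≥n⇒m⊓n≡n fits ⟩
    ∣ X ∣ + ∣ Y ∣                ≡⟨ sym (∣X++Y∣ X Y) ⟩
    ∣ X ++ Y ∣                   ∎
    where open ≡-Reasoning

  loops-independent⁻ : ∀ (Z : Subset (s + t)) → Independent (n0Rank {s} N) Z →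
    take s Z ≡ ⊥ × Independent σ (drop s Z)
  loops-independent⁻ Z indZ =
    Empty-unique (∣p∣≡0⇒Empty ∣X∣≡0) , trans indZ′ (cong (_+ ∣ drop s Z ∣) ∣X∣≡0)
    where
    indZ′ : σ (drop s Z) ≡ ∣ take s Z ∣ + ∣ drop s Z ∣
    indZ′ = trans indZ (∣take∣+∣drop∣ s Z)
    ∣X∣≡0 : ∣ take s Z ∣ ≡ 0
    ∣X∣≡0 = n≤0⇒n≡0 (+-cancelʳ-≤ ∣ drop s Z ∣ _ 0 (subst (_≤ ∣ drop s Z ∣) indZ′ (Nʳ.r-bound (drop s Z))))

  loops-independent⁺ : ∀ {Y} → Independent σ Y → Independent (n0Rank {s} N) (⊥ ++ Y)
  loops-independent⁺ {Y} indY = trans (cong σ (drop-++ (⊥ {s}) Y))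
    (trans indY (sym (trans (∣X++Y∣ (⊥ {s}) Y) (cong (_+ ∣ Y ∣) (∣⊥∣≡0 s)))))

  feasible⁺ : ∀ {A B} I → PrincipalSumIndep M N A B I → Feasible A B (take s I) (drop s I)
  feasible⁺ {A} {B} _ (Z₁ , Z₂ , refl , indZ₁ , indZ₂)
    with indX₁ , Y₁⊆B , fits₁ ← plus-independent⁻ Z₁ indZ₁
       | X₂≡⊥ , indY₂ ← loops-independent⁻ Z₂ indZ₂ =
    subst₂ (Feasible A B) (sym S-part) (sym (drop-zipWith _ Z₁ Z₂))
      (indX₁ , Nᶠ.independent-⊆ Y─B⊆Y₂ indY₂ , fits)
    where
    X₁ = take s Z₁
    Y₁ = drop s Z₁
    Y₂ = drop s Z₂
    S-part : take s (Z₁ ∪ Z₂) ≡ X₁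
    S-part = trans (take-zipWith _ Z₁ Z₂) (trans (cong (X₁ ∪_) X₂≡⊥) (∪-identityʳ X₁))
    Y─B⊆Y₂ : (Y₁ ∪ Y₂) ─ B ⊆ Y₂
    Y─B⊆Y₂ m = let y∈Y , y∉B = ∈─⁻ m in
      [ (λ y∈Y₁ → contradiction (Y₁⊆B y∈Y₁) y∉B) , (λ y∈Y₂ → y∈Y₂) ] (x∈p∪q⁻ Y₁ Y₂ y∈Y)
    fits : ∣ X₁ ∣ + ∣ Y₁ ∪ Y₂ ∣ ≤ ρ (X₁ ∪ A) + σ (Y₁ ∪ Y₂)
    fits = begin
      ∣ X₁ ∣ + ∣ Y₁ ∪ Y₂ ∣          ≤⟨ +-monoʳ-≤ ∣ X₁ ∣ (∣p∪q∣≤∣p∣+∣q∣ Y₁ Y₂) ⟩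
      ∣ X₁ ∣ + (∣ Y₁ ∣ + ∣ Y₂ ∣)    ≡⟨ sym (+-assoc ∣ X₁ ∣ _ _) ⟩
      ∣ X₁ ∣ + ∣ Y₁ ∣ + ∣ Y₂ ∣      ≤⟨ +-mono-≤ fits₁ (≤-reflexive (sym indY₂)) ⟩
      ρ (X₁ ∪ A) + σ Y₂             ≤⟨ +-monoʳ-≤ (ρ (X₁ ∪ A)) (Nʳ.r-mono _ _ (q⊆p∪q Y₁ Y₂)) ⟩
      ρ (X₁ ∪ A) + σ (Y₁ ∪ Y₂)      ∎
      where open ≤-Reasoning

  -- Conversely a feasible split is realised by choosing a basis J of Y containing
  -- Y ─ B: J goes to N₀ and the rest (inside B) goes to M⁺(A,B) together with X.
  feasible⁻ : ∀ {A B} I → Feasible A B (take s I) (drop s I) → PrincipalSumIndep M N A B I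
  feasible⁻ {A} {B} I (indX , indY─B , fits)
    with J , Y─B⊆J , J⊆Y , indJ , σJ≡σY ← Nᶠ.basis-extension (p─q⊆p (drop s I) B) indY─B =
    X ++ (Y ─ J) , ⊥ ++ J , sym I≡Z₁∪Z₂ ,
    plus-independent⁺ indX Y─J⊆B fits′ , loops-independent⁺ indJ
    where
    X = take s I
    Y = drop s I
    I≡Z₁∪Z₂ : (X ++ (Y ─ J)) ∪ (⊥ ++ J) ≡ I
    I≡Z₁∪Z₂ = begin
      (X ++ (Y ─ J)) ∪ (⊥ ++ J)    ≡⟨ zipWith-++ _ X (Y ─ J) ⊥ J ⟩
      (X ∪ ⊥) ++ ((Y ─ J) ∪ J)     ≡⟨ cong₂ _++_ (∪-identityʳ X) ([p─q]∪q≡p J⊆Y) ⟩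
      X ++ Y                       ≡⟨ take++drop≡id s I ⟩
      I                            ∎
      where open ≡-Reasoning
    -- an element of Y outside B would lie in Y ─ B ⊆ J
    Y─J⊆B : Y ─ J ⊆ B
    Y─J⊆B {y} m with y ∈? B
    ... | yes y∈B = y∈B
    ... | no  y∉B = let y∈Y , y∉J = ∈─⁻ m in contradiction (Y─B⊆J (x∈p∧x∉q⇒x∈p─q y∈Y y∉B)) y∉J
    fits′ : ∣ X ∣ + ∣ Y ─ J ∣ ≤ ρ (X ∪ A)
    fits′ = +-cancelʳ-≤ ∣ J ∣ _ _ (begin
      ∣ X ∣ + ∣ Y ─ J ∣ + ∣ J ∣     ≡⟨ +-assoc ∣ X ∣ _ _ ⟩
      ∣ X ∣ + (∣ Y ─ J ∣ + ∣ J ∣)   ≡⟨ cong (∣ X ∣ +_) (sym (∣p∣≡∣p─q∣+∣q∣ J⊆Y)) ⟩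
      ∣ X ∣ + ∣ Y ∣                 ≤⟨ fits ⟩
      ρ (X ∪ A) + σ Y               ≡⟨ cong (ρ (X ∪ A) +_) (trans (sym σJ≡σY) indJ) ⟩
      ρ (X ∪ A) + ∣ J ∣             ∎)
      where open ≤-Reasoning

  feasible-++ : ∀ {A B} X Y → PrincipalSumIndep M N A B (X ++ Y) ⇔ Feasible A B X Y
  feasible-++ {A} {B} X Y = mk⇔
    (subst₂ (Feasible A B) (take-++ X Y) (drop-++ X Y) ∘ feasible⁺ (X ++ Y))
    (feasible⁻ (X ++ Y) ∘ subst₂ (Feasible A B) (sym (take-++ X Y)) (sym (drop-++ X Y)))

  FeasibleTransfer : Subset s → Subset t → Subset s → Subset t → Set
  FeasibleTransfer A B A′ B′ = ∀ {X Y} → Feasible A B X Y → Feasible A′ B′ X Y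

  transfer⇒independent : ∀ {A B A′ B′} → FeasibleTransfer A B A′ B′ →
    ∀ I → PrincipalSumIndep M N A B I → PrincipalSumIndep M N A′ B′ I
  transfer⇒independent transfer I = feasible⁻ I ∘ transfer ∘ feasible⁺ I

  independent⇒transfer : ∀ {A B A′ B′} →
    (∀ I → PrincipalSumIndep M N A B I → PrincipalSumIndep M N A′ B′ I) → FeasibleTransfer A B A′ B′
  independent⇒transfer inclusion {X} {Y} =
    Equivalence.to (feasible-++ X Y) ∘ inclusion (X ++ Y) ∘ Equivalence.from (feasible-++ X Y)

  closures-transfer : ∀ {A A′ B B′} → closure ρ A ≡ closure ρ A′ →
    closure (dualRank σ) B ≡ closure (dualRank σ) B′ → FeasibleTransfer A B A′ B′
  closures-transfer {A} {A′} sameA sameB {X} {Y} (indX , indY─B , fits) =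
    indX , Nᶜ.independent-─-invariant sameB indY─B ,
    ≤-trans fits (+-monoˡ-≤ (σ Y) (Mᶠ.rank-∪-closure A⊆clA′ X))
    where
    A⊆clA′ : A ⊆ closure ρ A′
    A⊆clA′ = subst (A ⊆_) sameA (⊆closure ρ)

  -- A feasible split with dependent T-part; these are what separate (M,N;A,B) from M ⊕ N.
  Excess : Subset s → Subset t → Set
  Excess A B = ∃₂ λ X Y → Feasible A B X Y × ¬ Independent σ Y

  excess? : ∀ A B → Dec (Excess A B)
  excess? A B = anySubset? λ X → anySubset? λ Y →
    ((ρ X ≟ ∣ X ∣) ×-dec (σ (Y ─ B) ≟ ∣ Y ─ B ∣) ×-dec (∣ X ∣ + ∣ Y ∣ ≤? ρ (X ∪ A) + σ Y)) ×-dec ¬? (σ Y ≟ ∣ Y ∣)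

  no-excess⇒direct-sum : ∀ {A B} → ¬ Excess A B →
    SameMatroid (PrincipalSumIndep M N A B) (Independent (directSumRank M N))
  no-excess⇒direct-sum {A} {B} none I = to , from
    where
    X = take s I
    Y = drop s I
    to : PrincipalSumIndep M N A B I → Independent (directSumRank M N) I
    to indI with feasible⁺ I indI
    ... | feasible with σ Y ≟ ∣ Y ∣
    ...   | yes indY = trans (cong₂ _+_ (proj₁ feasible) indY) (sym (∣take∣+∣drop∣ s I))
    ...   | no  depY = ⊥-elim (none (X , Y , feasible , depY))
    from : Independent (directSumRank M N) I → PrincipalSumIndep M N A B I
    from indI = feasible⁻ I (indX , Nᶠ.independent-⊆ (p─q⊆p Y B) indY ,
      ≤-trans (≤-reflexive (cong₂ _+_ (sym indX) (sym indY))) (+-monoˡ-≤ (σ Y) (Mʳ.r-mono _ _ (p⊆p∪q A))))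
      where
      tight = tight-sum (Mʳ.r-bound X) (Nʳ.r-bound Y) (≤-reflexive (trans (sym (∣take∣+∣drop∣ s I)) (sym indI)))
      indX = proj₁ tight
      indY = proj₂ tight

  excess-rank : ∀ {A B} → Excess A B → 1 ≤ ρ A
  excess-rank {A} (X , Y , (indX , _ , fits) , depY) =
    +-cancelʳ-≤ (σ Y) 1 (ρ A) (+-cancelˡ-≤ ∣ X ∣ _ _ (begin
      ∣ X ∣ + suc (σ Y)       ≤⟨ +-monoʳ-≤ ∣ X ∣ (≤∧≢⇒< (Nʳ.r-bound Y) depY) ⟩
      ∣ X ∣ + ∣ Y ∣           ≤⟨ fits ⟩
      ρ (X ∪ A) + σ Y         ≤⟨ +-monoˡ-≤ (σ Y) (Mᶠ.subadditive X A) ⟩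
      ρ X + ρ A + σ Y         ≡⟨ trans (cong (λ k → k + ρ A + σ Y) indX) (+-assoc ∣ X ∣ _ _) ⟩
      ∣ X ∣ + (ρ A + σ Y)     ∎))
    where open ≤-Reasoning

  excess-nullity-one : ∀ {A B} → Excess A B → ∃ λ Y₁ → Independent σ (Y₁ ─ B) × ∣ Y₁ ∣ ≡ suc (σ Y₁)
  excess-nullity-one {B = B} (_ , Y , (_ , indY─B , _) , depY)
    with J , y , Y─B⊆J , J∪y⊆Y , y∉J , indJ , spanned ← Nᶠ.nullity-one-subset (p─q⊆p Y B) indY─B depY =
    J ∪ ⁅ y ⁆ , Nᶠ.independent-⊆ Y₁─B⊆J indJ , Nᶠ.nullity-one y∉J indJ spanned
    where
    -- y itself lies in B, since Y ─ B ⊆ J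
    Y₁─B⊆J : (J ∪ ⁅ y ⁆) ─ B ⊆ J
    Y₁─B⊆J m with x∈J∪y , x∉B ← ∈─⁻ m with ∈∪⁅⁆⁻ x∈J∪y
    ... | inj₁ x∈J = x∈J
    ... | inj₂ refl = contradiction (Y─B⊆J (x∈p∧x∉q⇒x∈p─q (J∪y⊆Y e∈∪⁅e⁆) x∉B)) y∉J

  -- Transfer of feasible splits, given a nullity-one T-set Y₁ with Y₁ ─ B independent,
  -- forces cl_M(A) ⊆ cl_M(A′): on a basis X of A′, the set A adds no rank.
  closure-transfer : ∀ {A B A′ B′ Y₁} → FeasibleTransfer A B A′ B′ →
    Independent σ (Y₁ ─ B) → ∣ Y₁ ∣ ≡ suc (σ Y₁) → closure ρ A ⊆ closure ρ A′
  closure-transfer {A} {A′ = A′} {Y₁ = Y₁} transfer indY₁─B nullity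
    with X , _ , X⊆A′ , indX , ρX≡ρA′ ← Mᶠ.basis-extension (⊆-min A′) Mᶠ.⊥-independent =
    Mᶠ.closure-⊆ X⊆A′ (≤-trans A-adds-nothing (≤-reflexive (sym indX)))
    where
    open ≤-Reasoning
    -- if A raised the rank of X, the split (X, Y₁) would be feasible for (A,B)
    -- but, having nullity one over the basis X of A′, not for (A′,B′)
    A-adds-nothing : ρ (X ∪ A) ≤ ∣ X ∣
    A-adds-nothing with suc ∣ X ∣ ≤? ρ (X ∪ A)
    ... | no  no-gain = s≤s⁻¹ (≰⇒> no-gain)
    ... | yes gain    = contradiction (+-cancelˡ-≤ ∣ X ∣ _ _ (begin
      ∣ X ∣ + suc (σ Y₁)   ≡⟨ cong (∣ X ∣ +_) (sym nullity) ⟩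
      ∣ X ∣ + ∣ Y₁ ∣       ≤⟨ proj₂ (proj₂ (transfer (indX , indY₁─B , fits))) ⟩
      ρ (X ∪ A′) + σ Y₁    ≤⟨ +-monoˡ-≤ (σ Y₁) (Mʳ.r-mono _ _ (∪⊆ X⊆A′ ⊆-refl)) ⟩
      ρ A′ + σ Y₁          ≡⟨ cong (_+ σ Y₁) (trans (sym ρX≡ρA′) indX) ⟩
      ∣ X ∣ + σ Y₁         ∎)) 1+n≰n
      where
      fits : ∣ X ∣ + ∣ Y₁ ∣ ≤ ρ (X ∪ A) + σ Y₁
      fits = begin
        ∣ X ∣ + ∣ Y₁ ∣       ≡⟨ cong (∣ X ∣ +_) nullity ⟩
        ∣ X ∣ + suc (σ Y₁)   ≡⟨ +-suc ∣ X ∣ (σ Y₁) ⟩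
        suc ∣ X ∣ + σ Y₁     ≤⟨ +-monoˡ-≤ (σ Y₁) gain ⟩
        ρ (X ∪ A) + σ Y₁     ∎

  -- Transfer of feasible splits with ρ A ≥ 1 forces cl_{N*}(B) ⊆ cl_{N*}(B′): an element
  -- e ∈ cl_{N*}(B) outside cl_{N*}(B′) closes a nullity-one set Y ⊆ ∁ B′ whose split (⊥, Y)
  -- is feasible for (A,B) but not for (A′,B′).
  coclosure-transfer : ∀ {A B A′ B′} → FeasibleTransfer A B A′ B′ → 1 ≤ ρ A →
    closure (dualRank σ) B ⊆ closure (dualRank σ) B′
  coclosure-transfer {A} {B} {B′ = B′} transfer rankA {e} e∈clB with e ∈? closure (dualRank σ) B′
  ... | yes e∈clB′ = e∈clB′
  ... | no  e∉clB′ with J , Y⊆∁B′ , e∉J , indJ , spanned ← Nᶜ.outside-coclosure-circuit e∉clB′ =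
    contradiction (Nᶠ.independent-⊆ Y⊆Y─B′ indY─B′) dependent
    where
    Y = J ∪ ⁅ e ⁆
    nullity : ∣ Y ∣ ≡ suc (σ Y)
    nullity = Nᶠ.nullity-one e∉J indJ spanned
    dependent : ¬ Independent σ Y
    dependent indY = 1+n≢n (sym (trans indY nullity))
    -- e ∈ cl_{N*}(B), so Y ─ B is independent ...
    Y─clB⊆J : Y ─ closure (dualRank σ) B ⊆ J
    Y─clB⊆J m with x∈Y , x∉clB ← ∈─⁻ m with ∈∪⁅⁆⁻ x∈Y
    ... | inj₁ x∈J = x∈J
    ... | inj₂ refl = contradiction e∈clB x∉clB
    fits : ∣ ⊥ {s} ∣ + ∣ Y ∣ ≤ ρ (⊥ ∪ A) + σ Y
    fits = begin
      ∣ ⊥ {s} ∣ + ∣ Y ∣    ≡⟨ cong₂ _+_ (∣⊥∣≡0 s) nullity ⟩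
      1 + σ Y              ≤⟨ +-monoˡ-≤ (σ Y) rankA ⟩
      ρ A + σ Y            ≡⟨ cong (λ S → ρ S + σ Y) (sym (∪-identityˡ A)) ⟩
      ρ (⊥ ∪ A) + σ Y      ∎
      where open ≤-Reasoning
    indY─B : Independent σ (Y ─ B)
    indY─B = Nᶜ.independent-─-coclosure (Nᶠ.independent-⊆ Y─clB⊆J indJ)
    -- ... and (⊥, Y) is feasible for (A,B), hence for (A′,B′); but Y ─ B′ = Y is dependent
    indY─B′ : Independent σ (Y ─ B′)
    indY─B′ = proj₁ (proj₂ (transfer (Mᶠ.⊥-independent , indY─B , fits)))
    Y⊆Y─B′ : Y ⊆ Y ─ B′
    Y⊆Y─B′ y∈Y = x∈p∧x∉q⇒x∈p─q y∈Y (x∈∁p⇒x∉p (Y⊆∁B′ y∈Y))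

  closures-unique : ∀ {A A′ B B′} →
    ¬ SameMatroid (PrincipalSumIndep M N A B) (Independent (directSumRank M N)) →
    SameMatroid (PrincipalSumIndep M N A B) (PrincipalSumIndep M N A′ B′) →
    (closure ρ A ≡ closure ρ A′) × (closure (dualRank σ) B ≡ closure (dualRank σ) B′)
  closures-unique {A} {A′} {B} {B′} not-direct same with excess? A B
  ... | no  none   = ⊥-elim (not-direct (no-excess⇒direct-sum none))
  ... | yes excess =
    ⊆-antisym (closure-transfer forth (proj₁ (proj₂ Y₁)) (proj₂ (proj₂ Y₁)))
              (closure-transfer back (proj₁ (proj₂ Y₁′)) (proj₂ (proj₂ Y₁′))) ,
    ⊆-antisym (coclosure-transfer forth (excess-rank excess)) (coclosure-transfer back (excess-rank excess′))
    where
    forth : FeasibleTransfer A B A′ B′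
    forth = independent⇒transfer (λ I → proj₁ (same I))
    back : FeasibleTransfer A′ B′ A B
    back = independent⇒transfer (λ I → proj₂ (same I))
    excess′ : Excess A′ B′
    excess′ = let X , Y , feasible , depY = excess in X , Y , forth feasible , depY
    Y₁ = excess-nullity-one excess
    Y₁′ = excess-nullity-one excess′

theorem3p19 : ∀ {s t} (M : Matroid s) (N : Matroid t) (A A' : Subset s) (B B' : Subset t) →
    ((closure (rank M) A ≡ closure (rank M) A')
      × (closure (dualRank (rank N)) B ≡ closure (dualRank (rank N)) B')
      → SameMatroid (PrincipalSumIndep M N A B) (PrincipalSumIndep M N A' B'))
  × (¬ SameMatroid (PrincipalSumIndep M N A B) (Independent (directSumRank M N))
      → SameMatroid (PrincipalSumIndep M N A B) (PrincipalSumIndep M N A' B')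
      → (closure (rank M) A ≡ closure (rank M) A')
        × (closure (dualRank (rank N)) B ≡ closure (dualRank (rank N)) B'))
theorem3p19 M N A A' B B' = same-principal-sum , closures-unique
  where
  open PrincipalSum M N
  same-principal-sum : (closure (rank M) A ≡ closure (rank M) A')
                         × (closure (dualRank (rank N)) B ≡ closure (dualRank (rank N)) B') →
                       SameMatroid (PrincipalSumIndep M N A B) (PrincipalSumIndep M N A' B')
  same-principal-sum (sameA , sameB) I =
    transfer⇒independent (closures-transfer sameA sameB) I ,
    transfer⇒independent (closures-transfer (sym sameA) (sym sameB)) I
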